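{- Let $n$, $t$ and $s$ be positive integers with $n\geq t+s+2$. Suppose $\mathcal{F}\subseteq \binom{[n]}{t+1}$ is an $s$-almost $t$-intersecting family which is not $t$-intersecting and which has the maximum size among all $s$-almost $t$-intersecting subfamilies of $\binom{[n]}{t+1}$ that are not $t$-intersecting. Then $|F_{1}\cap F_{2}|\geq t-1$ for all $F_{1}, F_{2}\in \mathcal{F}$.
   Context: $\mathcal{F}\subseteq\binom{[n]}{k}$ is $s$-almost $t$-intersecting if $\left|\{F'\in\mathcal{F}: |F'\cap F|<t\}\right|\leq s$ for every $F\in\mathcal{F}$; it is $t$-intersecting if any two members share at least $t$ elements. -}

module Defs where

open import Data.Nat using (ℕ; _<_; _≤_; _<?_)
open import Data.Fin.Subset using (Subset; ∣_∣; _∩_)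
open import Data.List using (List; length; filter)
open import Data.List.Membership.Propositional using (_∈_)
open import Data.List.Relation.Unary.All using (All)
open import Data.List.Relation.Unary.Unique.Propositional using (Unique)
open import Data.Product using (_×_; ∃-syntax)
open import Relation.Nullary using (¬_)
open import Relation.Binary.PropositionalEquality using (_≡_)

-- A family 𝓕 ⊆ ([n] choose k) is represented as a duplicate-free list of
-- subsets of [n] = Fin n, each of cardinality k; |𝓕| = length 𝓕.
IsFamily : (n k : ℕ) → List (Subset n) → Set
IsFamily n k 𝓕 = Unique 𝓕 × All (λ F → ∣ F ∣ ≡ k) 𝓕

badFor : {n : ℕ} → ℕ → List (Subset n) → Subset n → List (Subset n)
badFor t 𝓕 F = filter (λ F' → ∣ F' ∩ F ∣ <? t) 𝓕

AlmostIntersecting : {n : ℕ} → ℕ → ℕ → List (Subset n) → Set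
AlmostIntersecting s t 𝓕 = ∀ F → F ∈ 𝓕 → length (badFor t 𝓕 F) ≤ s

-- t-intersecting: any two members share at least t elements
-- (for k-uniform families with t ≤ k this is vacuous for F₁ = F₂)
Intersecting : {n : ℕ} → ℕ → List (Subset n) → Set
Intersecting t 𝓕 = ∀ F₁ F₂ → F₁ ∈ 𝓕 → F₂ ∈ 𝓕 → t ≤ ∣ F₁ ∩ F₂ ∣

{-# OPTIONS --safe #-}
module Submission where

-- If |F₁ ∩ F₂| < t − 1, every (t + 1)-set F has |F ∩ F₁| + |F ∩ F₂| ≤ |F| + |F₁ ∩ F₂| < 2t, so F
-- meets F₁ or F₂ in fewer than t elements; an s-almost t-intersecting family containing F₁ and F₂
-- therefore has at most 2s members.  But there is an s-almost t-intersecting, not t-intersecting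
-- family of 2s + 1 sets of size t + 1: the edges of a graph with that property for t = 1, each
-- enlarged by a common (t − 1)-set.  So a maximum family has no such pair F₁, F₂.

open import Defs
open import Data.Nat using (ℕ; suc; _+_; _≤_; _<_; _≥_; _∸_; _<?_; _≤?_; z≤n; s≤s)
open import Data.Nat.Properties
open import Data.Nat.Tactic.RingSolver using (solve-∀)
open import Data.Bool using (true; false; _∧_)
open import Data.Fin using (Fin; zero; suc; inject₁)
open import Data.Fin.Properties as Fin using (inject₁-injective)
open import Data.Fin.Subset using (Subset; ∣_∣; _∩_; inside; outside; ⊥; ⊤; ⁅_⁆) renaming (_∈_ to _∈ₛ_)
open import Data.Fin.Subset.Properties using (∣p∣≤∣x∷p∣; ∣⊥∣≡0; ∣⊤∣≡n; ∣⁅x⁆∣≡1; ∩-idem; x∈⁅x⁆; x∈⁅y⁆⇒x≡y)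
open import Data.Vec using ([]; _∷_; _++_)
open import Data.Vec.Properties using (zipWith-++; ++-injectiveˡ; ∷-injectiveʳ)
open import Data.List as List using (List; []; _∷_; length; filter; map; tabulate)
open import Data.List.Properties using (filter-++; filter-none; filter-≐; length-filter; length-map; length-++; length-tabulate; ++-identityʳ)
open import Data.List.Membership.Propositional using (_∈_)
open import Data.List.Membership.Propositional.Properties using (∈-map⁺; ∈-map⁻; ∈-++⁻; ∈-++⁺ˡ; ∈-++⁺ʳ; ∈-tabulate⁺; ∈-tabulate⁻)
open import Data.List.Relation.Unary.Any using (here; there)
open import Data.List.Relation.Unary.All as All using (All; []; _∷_)
open import Data.List.Relation.Unary.All.Properties as All using ()
open import Data.List.Relation.Unary.AllPairs using (_∷_)
open import Data.List.Relation.Unary.Unique.Propositional using (Unique)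
import Data.List.Relation.Unary.Unique.Propositional.Properties as Unique
open import Data.Product using (_×_; _,_; ∃-syntax)
open import Data.Sum using (_⊎_; inj₁; inj₂; [_,_])
open import Data.Empty using (⊥-elim)
open import Function using (_∘_)
open import Relation.Nullary using (¬_; yes; no; does; contradiction)
open import Relation.Nullary.Decidable using (decidable-stable)
open import Relation.Unary using (Pred; Decidable; ∁)
open import Relation.Binary.PropositionalEquality using (_≡_; refl; sym; trans; cong; cong₂; subst; module ≡-Reasoning)

⁅⁆-injective : ∀ {n} {i j : Fin n} → ⁅ i ⁆ ≡ ⁅ j ⁆ → i ≡ j
⁅⁆-injective {i = i} {j} eq = x∈⁅y⁆⇒x≡y j (subst (i ∈ₛ_) eq (x∈⁅x⁆ i))

∣p++q∣≡∣p∣+∣q∣ : ∀ {m n} (p : Subset m) (q : Subset n) → ∣ p ++ q ∣ ≡ ∣ p ∣ + ∣ q ∣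
∣p++q∣≡∣p∣+∣q∣ []            q = refl
∣p++q∣≡∣p∣+∣q∣ (inside  ∷ p) q = cong suc (∣p++q∣≡∣p∣+∣q∣ p q)
∣p++q∣≡∣p∣+∣q∣ (outside ∷ p) q = ∣p++q∣≡∣p∣+∣q∣ p q

∣p∩q∣+∣p∩r∣≤∣p∣+∣q∩r∣ : ∀ {n} (p q r : Subset n) → ∣ p ∩ q ∣ + ∣ p ∩ r ∣ ≤ ∣ p ∣ + ∣ q ∩ r ∣
∣p∩q∣+∣p∩r∣≤∣p∣+∣q∩r∣ [] [] [] = z≤n
∣p∩q∣+∣p∩r∣≤∣p∣+∣q∩r∣ (outside ∷ p) (x ∷ q) (y ∷ r) =
  ≤-trans (∣p∩q∣+∣p∩r∣≤∣p∣+∣q∩r∣ p q r) (+-monoʳ-≤ ∣ p ∣ (∣p∣≤∣x∷p∣ (x ∧ y) (q ∩ r)))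
∣p∩q∣+∣p∩r∣≤∣p∣+∣q∩r∣ (inside ∷ p) (inside ∷ q) (inside ∷ r)
  rewrite +-suc ∣ p ∩ q ∣ ∣ p ∩ r ∣ | +-suc ∣ p ∣ ∣ q ∩ r ∣ = s≤s (s≤s (∣p∩q∣+∣p∩r∣≤∣p∣+∣q∩r∣ p q r))
∣p∩q∣+∣p∩r∣≤∣p∣+∣q∩r∣ (inside ∷ p) (inside ∷ q) (outside ∷ r) = s≤s (∣p∩q∣+∣p∩r∣≤∣p∣+∣q∩r∣ p q r)
∣p∩q∣+∣p∩r∣≤∣p∣+∣q∩r∣ (inside ∷ p) (outside ∷ q) (inside ∷ r)
  rewrite +-suc ∣ p ∩ q ∣ ∣ p ∩ r ∣ = s≤s (∣p∩q∣+∣p∩r∣≤∣p∣+∣q∩r∣ p q r)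
∣p∩q∣+∣p∩r∣≤∣p∣+∣q∩r∣ (inside ∷ p) (outside ∷ q) (outside ∷ r) = m≤n⇒m≤1+n (∣p∩q∣+∣p∩r∣≤∣p∣+∣q∩r∣ p q r)

length≤filter+filter : ∀ {a p q} {A : Set a} {P : Pred A p} {Q : Pred A q}
                       (P? : Decidable P) (Q? : Decidable Q) xs → All (λ x → P x ⊎ Q x) xs →
                       length xs ≤ length (filter P? xs) + length (filter Q? xs)
length≤filter+filter P? Q? [] [] = z≤n
length≤filter+filter P? Q? (x ∷ xs) (Px⊎Qx ∷ all)
  with ih ← length≤filter+filter P? Q? xs all | P? x | Q? x
... | yes _  | yes _  = s≤s (≤-trans ih (+-monoʳ-≤ _ (n≤1+n _)))
... | yes _  | no _   = s≤s ih
... | no _   | yes _  = ≤-trans (s≤s ih) (≤-reflexive (sym (+-suc _ _)))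
... | no ¬Px | no ¬Qx = ⊥-elim ([ ¬Px , ¬Qx ] Px⊎Qx)

module _ {a p} {A : Set a} {P : Pred A p} (P? : Decidable P) where

  filter-map : ∀ {b} {B : Set b} (f : B → A) xs → filter P? (map f xs) ≡ map f (filter (P? ∘ f) xs)
  filter-map f [] = refl
  filter-map f (x ∷ xs) with does (P? (f x))
  ... | true  = cong (f x ∷_) (filter-map f xs)
  ... | false = filter-map f xs

  length-filter-++-noneˡ : ∀ xs ys → All (∁ P) xs → length (filter P? (xs List.++ ys)) ≤ length ys
  length-filter-++-noneˡ xs ys none rewrite filter-++ P? xs ys | filter-none P? none = length-filter P? ys

  length-filter-++-noneʳ : ∀ xs ys → All (∁ P) ys → length (filter P? (xs List.++ ys)) ≤ length xs
  length-filter-++-noneʳ xs ys none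
    rewrite filter-++ P? xs ys | filter-none P? none | ++-identityʳ (filter P? xs) = length-filter P? xs

+<+⇒<⊎< : ∀ {a b t} → a + b < t + t → a < t ⊎ b < t
+<+⇒<⊎< {a} {b} {t} a+b<t+t with a <? t
... | yes a<t = inj₁ a<t
... | no  a≮t = inj₂ (+-cancelˡ-< t b t (≤-<-trans (+-monoˡ-≤ b (≮⇒≥ a≮t)) a+b<t+t))

farPair⇒length≤s+s : ∀ {n k s t} {𝓕 : List (Subset n)} {F₁ F₂} → All (λ F → ∣ F ∣ ≡ k) 𝓕 →
                     AlmostIntersecting s t 𝓕 → F₁ ∈ 𝓕 → F₂ ∈ 𝓕 → k + ∣ F₁ ∩ F₂ ∣ < t + t →
                     length 𝓕 ≤ s + s
farPair⇒length≤s+s {k = k} {s} {t} {𝓕} {F₁} {F₂} sizes almost F₁∈ F₂∈ far = begin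
  length 𝓕                                          ≤⟨ length≤filter+filter _ _ 𝓕 (All.map (λ {F} → bad {F}) sizes) ⟩
  length (badFor t 𝓕 F₁) + length (badFor t 𝓕 F₂)  ≤⟨ +-mono-≤ (almost F₁ F₁∈) (almost F₂ F₂∈) ⟩
  s + s                                             ∎
  where
  open ≤-Reasoning
  bad : ∀ {F} → ∣ F ∣ ≡ k → ∣ F ∩ F₁ ∣ < t ⊎ ∣ F ∩ F₂ ∣ < t
  bad {F} ∣F∣≡k = +<+⇒<⊎< (≤-<-trans (∣p∩q∣+∣p∩r∣≤∣p∣+∣q∩r∣ F F₁ F₂)
                             (subst (λ m → m + ∣ F₁ ∩ F₂ ∣ < t + t) (sym ∣F∣≡k) far))

<t∸1⇒1+t+c<t+t : ∀ {c t} → c < t ∸ 1 → suc t + c < t + t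
<t∸1⇒1+t+c<t+t {t = suc t} c<t rewrite +-suc t t = s≤s (s≤s (+-monoʳ-< t c<t))

AlmostButNotIntersecting : (n k s t : ℕ) → List (Subset n) → Set
AlmostButNotIntersecting n k s t 𝓕 = IsFamily n k 𝓕 × AlmostIntersecting s t 𝓕 × ¬ Intersecting t 𝓕

extend : ∀ {m r} → Subset r → Subset m → Subset (m + r)
extend R p = p ++ R

module _ {m r c : ℕ} (R : Subset r) (∣R∣≡c : ∣ R ∣ ≡ c) where

  ∣extend∣ : ∀ (p : Subset m) → ∣ extend R p ∣ ≡ ∣ p ∣ + c
  ∣extend∣ p = trans (∣p++q∣≡∣p∣+∣q∣ p R) (cong (∣ p ∣ +_) ∣R∣≡c)

  ∣extend∩extend∣ : ∀ (p q : Subset m) → ∣ extend R p ∩ extend R q ∣ ≡ ∣ p ∩ q ∣ + c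
  ∣extend∩extend∣ p q = begin
    ∣ (p ++ R) ∩ (q ++ R) ∣  ≡⟨ cong ∣_∣ (zipWith-++ _∧_ p R q R) ⟩
    ∣ (p ∩ q) ++ (R ∩ R) ∣   ≡⟨ cong (λ R′ → ∣ (p ∩ q) ++ R′ ∣) (∩-idem R) ⟩
    ∣ extend R (p ∩ q) ∣     ≡⟨ ∣extend∣ (p ∩ q) ⟩
    ∣ p ∩ q ∣ + c            ∎
    where open ≡-Reasoning

  length-badFor-extend : ∀ j (𝓗 : List (Subset m)) p →
                         length (badFor (j + c) (map (extend R) 𝓗) (extend R p)) ≡ length (badFor j 𝓗 p)
  length-badFor-extend j 𝓗 p = begin
    length (filter _ (map (extend R) 𝓗))     ≡⟨ cong length (filter-map _ (extend R) 𝓗) ⟩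
    length (map (extend R) (filter bad? 𝓗))  ≡⟨ length-map (extend R) (filter bad? 𝓗) ⟩
    length (filter bad? 𝓗)                   ≡⟨ cong length (filter-≐ bad? _ ((λ {q} → shrink {q}) , λ {q} → grow {q}) 𝓗) ⟩
    length (badFor j 𝓗 p)                    ∎
    where
    open ≡-Reasoning
    bad? : Decidable (λ q → ∣ extend R q ∩ extend R p ∣ < j + c)
    bad? q = ∣ extend R q ∩ extend R p ∣ <? j + c
    shrink : ∀ {q : Subset m} → ∣ extend R q ∩ extend R p ∣ < j + c → ∣ q ∩ p ∣ < j
    shrink {q} = +-cancelʳ-< c _ j ∘ subst (_< j + c) (∣extend∩extend∣ q p)
    grow : ∀ {q : Subset m} → ∣ q ∩ p ∣ < j → ∣ extend R q ∩ extend R p ∣ < j + c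
    grow {q} = subst (_< j + c) (sym (∣extend∩extend∣ q p)) ∘ +-monoˡ-< c

  extend-almostButNot : ∀ {k s j} {𝓗 : List (Subset m)} → AlmostButNotIntersecting m k s j 𝓗 →
                        AlmostButNotIntersecting (m + r) (k + c) s (j + c) (map (extend R) 𝓗)
  extend-almostButNot {k} {s} {j} {𝓗} ((unique , sizes) , almost , ¬intersecting) =
    (Unique.map⁺ (++-injectiveˡ _ _) unique , All.map⁺ (All.map (λ {p} → extendSize {p}) sizes)) ,
    extendAlmost , extend¬Intersecting
    where
    extendSize : ∀ {p : Subset m} → ∣ p ∣ ≡ k → ∣ extend R p ∣ ≡ k + c
    extendSize {p} ∣p∣≡k = trans (∣extend∣ p) (cong (_+ c) ∣p∣≡k)
    extendAlmost : AlmostIntersecting s (j + c) (map (extend R) 𝓗)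
    extendAlmost F F∈ with p , p∈ , refl ← ∈-map⁻ (extend R) F∈ =
      subst (_≤ s) (sym (length-badFor-extend j 𝓗 p)) (almost p p∈)
    extend¬Intersecting : ¬ Intersecting (j + c) (map (extend R) 𝓗)
    extend¬Intersecting intersecting = ¬intersecting λ p q p∈ q∈ →
      +-cancelʳ-≤ c j _ (subst (j + c ≤_) (∣extend∩extend∣ p q)
                                (intersecting _ _ (∈-map⁺ (extend R) p∈) (∈-map⁺ (extend R) q∈)))

-- The graph on the vertices x, y, a₀, …, aₛ (coordinates 0, 1, 2, …) with the 2s + 1 edges xy,
-- xaᵢ and yaᵢ₊₁ (i < s).  An edge xaᵢ can miss only edges yaⱼ₊₁ and vice versa, so each edge
-- misses at most s others; the shift of the second index makes xa₀ and ya₀ disjoint even if s = 1.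
module DoubleStar (s : ℕ) where

  xy : Subset (3 + s)
  xy = inside ∷ inside ∷ ⊥

  xa ya : Fin s → Subset (3 + s)
  xa i = inside ∷ outside ∷ ⁅ inject₁ i ⁆
  ya i = outside ∷ inside ∷ ⁅ suc i ⁆

  spokes doubleStar : List (Subset (3 + s))
  spokes = tabulate xa List.++ tabulate ya
  doubleStar = xy ∷ spokes

  All-spokes : ∀ {ℓ} {P : Pred (Subset (3 + s)) ℓ} → (∀ i → P (xa i)) → (∀ i → P (ya i)) → All P spokes
  All-spokes Pxa Pya = All.++⁺ (All.tabulate⁺ {f = xa} Pxa) (All.tabulate⁺ {f = ya} Pya)

  length-doubleStar : length doubleStar ≡ suc (s + s)
  length-doubleStar =
    cong suc (trans (length-++ (tabulate xa)) (cong₂ _+_ (length-tabulate xa) (length-tabulate ya)))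

  doubleStar-isFamily : IsFamily (3 + s) 2 doubleStar
  doubleStar-isFamily = unique , sizes
    where
    unique : Unique doubleStar
    unique = All-spokes (λ _ ()) (λ _ ())
           ∷ Unique.++⁺
               (Unique.tabulate⁺ {f = xa} (inject₁-injective ∘ ⁅⁆-injective ∘ ∷-injectiveʳ ∘ ∷-injectiveʳ))
               (Unique.tabulate⁺ {f = ya} (Fin.suc-injective ∘ ⁅⁆-injective ∘ ∷-injectiveʳ ∘ ∷-injectiveʳ))
               xa≢ya
      where
      xa≢ya : ∀ {F} → ¬ (F ∈ tabulate xa × F ∈ tabulate ya)
      xa≢ya (F∈xa , F∈ya) with i , refl ← ∈-tabulate⁻ F∈xa | j , () ← ∈-tabulate⁻ F∈ya
    sizes : All (λ F → ∣ F ∣ ≡ 2) doubleStar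
    sizes = cong (2 +_) (∣⊥∣≡0 (suc s))
          ∷ All-spokes (λ i → cong (1 +_) (∣⁅x⁆∣≡1 (inject₁ i))) (λ i → cong (1 +_) (∣⁅x⁆∣≡1 (suc i)))

  -- Edges sharing x or y have an intersection whose size computes to a successor, whence ≤⇒≯ (s≤s z≤n).
  doubleStar-almostIntersecting : AlmostIntersecting s 1 doubleStar
  doubleStar-almostIntersecting F (here refl) =
    subst (λ bad → length bad ≤ s) (sym (filter-none (λ F' → ∣ F' ∩ xy ∣ <? 1) meetsXy)) z≤n
    where
    meetsXy : All (λ F' → ¬ ∣ F' ∩ xy ∣ < 1) doubleStar
    meetsXy = ≤⇒≯ (s≤s z≤n) ∷ All-spokes (λ _ → ≤⇒≯ (s≤s z≤n)) (λ _ → ≤⇒≯ (s≤s z≤n))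
  doubleStar-almostIntersecting F (there F∈) with ∈-++⁻ (tabulate xa) F∈
  ... | inj₁ F∈xa with i , refl ← ∈-tabulate⁻ F∈xa =
    ≤-trans (length-filter-++-noneˡ _ (tabulate xa) (tabulate ya)
                                    (All.tabulate⁺ {f = xa} λ _ → ≤⇒≯ (s≤s z≤n)))
            (≤-reflexive (length-tabulate ya))
  ... | inj₂ F∈ya with i , refl ← ∈-tabulate⁻ F∈ya =
    ≤-trans (length-filter-++-noneʳ _ (tabulate xa) (tabulate ya)
                                    (All.tabulate⁺ {f = ya} λ _ → ≤⇒≯ (s≤s z≤n)))
            (≤-reflexive (length-tabulate xa))

open DoubleStar using (doubleStar; doubleStar-isFamily; doubleStar-almostIntersecting; length-doubleStar)

doubleStar-¬intersecting : ∀ s → ¬ Intersecting 1 (doubleStar (suc s))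
doubleStar-¬intersecting s intersecting =
  contradiction (subst (1 ≤_) xa₀∩ya₀ (intersecting _ _ xa₀∈ ya₀∈)) λ ()
  where
  open DoubleStar (suc s) using (xa; ya)
  xa₀∈ : xa zero ∈ doubleStar (suc s)
  xa₀∈ = there (∈-++⁺ˡ (∈-tabulate⁺ {f = xa} zero))
  ya₀∈ : ya zero ∈ doubleStar (suc s)
  ya₀∈ = there (∈-++⁺ʳ (tabulate xa) (∈-tabulate⁺ {f = ya} zero))
  xa₀∩ya₀ : ∣ xa zero ∩ ya zero ∣ ≡ 0
  xa₀∩ya₀ = trans (cong ∣_∣ (∩-idem (⊥ {s}))) (∣⊥∣≡0 s)

almostButNotIntersecting-2s+1 : ∀ {n t s} → 1 ≤ t → 1 ≤ s → t + s + 2 ≤ n →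
               ∃[ 𝓖 ] AlmostButNotIntersecting n (suc t) s t 𝓖 × length 𝓖 ≡ suc (s + s)
almostButNotIntersecting-2s+1 {t = suc t} {suc s} _ _ t+s+2≤n with r , refl ← m≤n⇒∃[o]m+o≡n t+s+2≤n =
  subst (λ n → ∃[ 𝓖 ] AlmostButNotIntersecting n (2 + t) (suc s) (suc t) 𝓖
                     × length 𝓖 ≡ suc (suc s + suc s))
        (dimension t (suc s) r)
        ( map (extend R) (doubleStar (suc s))
        , extend-almostButNot R ∣R∣≡t
            (doubleStar-isFamily (suc s) , doubleStar-almostIntersecting (suc s) , doubleStar-¬intersecting s)
        , trans (length-map (extend R) (doubleStar (suc s))) (length-doubleStar (suc s)))
  where
  R : Subset (t + r)
  R = ⊤ {t} ++ ⊥ {r}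
  ∣R∣≡t : ∣ R ∣ ≡ t
  ∣R∣≡t = trans (∣p++q∣≡∣p∣+∣q∣ (⊤ {t}) (⊥ {r}))
                (trans (cong₂ _+_ (∣⊤∣≡n t) (∣⊥∣≡0 r)) (+-identityʳ t))
  dimension : ∀ t s r → 3 + s + (t + r) ≡ suc t + s + 2 + r
  dimension = solve-∀

lemma5p4 : (n t s : ℕ) → 1 ≤ n → 1 ≤ t → 1 ≤ s → n ≥ t + s + 2 →
    (𝓕 : List (Subset n)) →
    IsFamily n (suc t) 𝓕 → AlmostIntersecting s t 𝓕 → ¬ Intersecting t 𝓕 →
    (∀ (𝓖 : List (Subset n)) → IsFamily n (suc t) 𝓖 → AlmostIntersecting s t 𝓖 →
       ¬ Intersecting t 𝓖 → length 𝓖 ≤ length 𝓕) →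
    ∀ F₁ F₂ → F₁ ∈ 𝓕 → F₂ ∈ 𝓕 → t ∸ 1 ≤ ∣ F₁ ∩ F₂ ∣
lemma5p4 n t s _ 1≤t 1≤s t+s+2≤n 𝓕 (_ , sizes) almost _ maximal F₁ F₂ F₁∈ F₂∈ =
  decidable-stable (t ∸ 1 ≤? ∣ F₁ ∩ F₂ ∣) λ far →
    let 𝓖 , (family , almost𝓖 , ¬intersecting𝓖) , ∣𝓖∣≡2s+1 = almostButNotIntersecting-2s+1 1≤t 1≤s t+s+2≤n
    in ≤⇒≯ (farPair⇒length≤s+s sizes almost F₁∈ F₂∈ (<t∸1⇒1+t+c<t+t (≰⇒> far)))
           (subst (_≤ length 𝓕) ∣𝓖∣≡2s+1 (maximal 𝓖 family almost𝓖 ¬intersecting𝓖))
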